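{- Fix a type $\sigma$ of $\mathsf{T}$. Let \[ \mathsf{J}\mathbb{N}=(\mathbb{N}^\mathbb{N}\to\mathbb{N})\times(\mathbb{N}^*\to\mathbf{2})\times\big((\mathbb{N}^*\to\sigma)\to(\mathbb{N}^*\to\sigma^\mathbb{N}\to\sigma)\to\mathbb{N}^*\to\sigma\big), \] writing $\mathrm{V}_w,\mathrm{S}_w,\mathrm{B}_w$ for the three components of $w:\mathsf{J}\mathbb{N}$. Define \[ \eta(n):=\langle\lambda\alpha.n,\ \lambda s.1,\ \lambda GH.G\rangle, \] \[ \kappa(g,w):=\big\langle\lambda\alpha.\mathrm{V}_{g(\mathrm{V}_w\alpha)}\alpha,\ \lambda s.\min(\mathrm{S}_w(s),\mathrm{S}_{g(\mathrm{V}_w\hat s)}(s)),\ \lambda GH.\mathrm{B}_w(\lambda s.\mathrm{B}_{g(\mathrm{V}_w\hat s)}(G,H,s),H)\big\rangle, \] and $\Omega:\mathsf{J}\mathbb{N}\to\mathsf{J}\mathbb{N}$ by $\Omega:=\kappa(\lambda n.\langle\lambda\alpha.\alpha n,\ \lambda s.\mathrm{Le}(n,|s|),\ \Psi n\rangle)$, where $\mathrm{Le}(n,k)=1$ iff $n<k$ (and $0$ otherwise), and $\Psi$ is a closed $\mathsf{T}$-term such that for all $n,G,H,s$: if $n<|s|$ then $\Psi n(G,H,s)=G(s)$, and if $n\ge|s|$ then $\Psi n(G,H,s)=H(s,\lambda m.\Psi n(G,H,s*m))$. Then for every closed term $Y:\mathbb{N}^\mathbb{N}\to\mathbb{N}$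 of $\mathsf{T}$: (1) $\mathrm{S}_{Y^\mathsf{J}\Omega}$ is a monotone predicate securing $Y$; and (2) $\mathrm{B}_{Y^\mathsf{J}\Omega}$ is a functional of general bar recursion for $\mathrm{S}_{Y^\mathsf{J}\Omega}$, i.e. $\mathcal{GBR}_{\mathrm{S}_{Y^\mathsf{J}\Omega}}(\mathrm{B}_{Y^\mathsf{J}\Omega})$ holds.
   Context: System $\mathsf{T}$ extended with products: types $\mathbb{N}$, $\sigma\to\tau$, $\sigma\times\tau$; terms: variables, $\lambda$, application, $0$, $\mathsf{suc}$, $\mathsf{rec}_\sigma:\sigma\to(\mathbb{N}\to\sigma\to\sigma)\to\mathbb{N}\to\sigma$ (with $\mathsf{rec}(a,f,0)=a$, $\mathsf{rec}(a,f,n+1)=f(n,\mathsf{rec}(a,f,n))$), and pairing $\langle\cdot,\cdot\rangle$ with projections. Terms are interpreted as functionals of finite type. $\mathbb{N}^\mathbb{N}=\mathbb{N}\to\mathbb{N}$, $\sigma^\mathbb{N}=\mathbb{N}\to\sigma$; $\mathbb{N}^*$ is the type of finite sequences of naturals and $\mathbf{2}=\{0,1\}$ (both encodable in $\mathsf{T}$); $\min$ returns the smaller argument. For $S:\mathbb{N}^*\to\mathbf{2}$, $S(s)$ means $S(s)=1$. For $s:\mathbb{N}^*$: $|s|$ is its length, $\hat s:\mathbb{N}^\mathbb{N}$ is $s$ extended by infinitely many $0$'s, $s*n$ appends $n$, and $s*\alpha$ is the concatenation with $\alpha:\mathbb{N}^\mathbb{N}$. $S$ is monotone if $S(s)$ implies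 $S(s*n)$ for all $s,n$. $S$ secures $Y:\mathbb{N}^\mathbb{N}\to\mathbb{N}$ if $\forall s\,(S(s)\to\forall\alpha\,Y(s*\alpha)=Y(\hat s))$. For $\xi:(\mathbb{N}^*\to\sigma)\to(\mathbb{N}^*\to\sigma^\mathbb{N}\to\sigma)\to\mathbb{N}^*\to\sigma$, $\mathcal{GBR}_S(\xi)$ means: for all $G,H,s$, if $S(s)$ then $\xi(G,H,s)=G(s)$, and if $\neg S(s)$ then $\xi(G,H,s)=H(s,\lambda n.\xi(G,H,s*n))$. The $\mathsf{J}$-translation for a nucleus $(\mathsf{J}\mathbb{N},\eta,\kappa)$ (type $\mathsf{J}\mathbb{N}$, terms $\eta:\mathbb{N}\to\mathsf{J}\mathbb{N}$, $\kappa:(\mathbb{N}\to\mathsf{J}\mathbb{N})\to\mathsf{J}\mathbb{N}\to\mathsf{J}\mathbb{N}$): $\mathbb{N}^\mathsf{J}:=\mathsf{J}\mathbb{N}$, $(\sigma\to\tau)^\mathsf{J}:=\sigma^\mathsf{J}\to\tau^\mathsf{J}$, $(\sigma\times\tau)^\mathsf{J}:=\sigma^\mathsf{J}\times\tau^\mathsf{J}$; variables $x:\sigma$ go to fresh $x^\mathsf{J}:\sigma^\mathsf{J}$, $(\lambda x.t)^\mathsf{J}:=\lambda x^\mathsf{J}.t^\mathsf{J}$, $(tu)^\mathsf{J}:=t^\mathsf{J}u^\mathsf{J}$, $0^\mathsf{J}:=\eta\,0$, $\mathsf{suc}^\mathsf{J}:=\kappa(\eta\circ\mathsf{suc})$,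 pairing and projections translate to themselves at translated types, $(\mathsf{rec}_\tau)^\mathsf{J}:=\lambda x f.\,\mathrm{ke}_\tau(\mathsf{rec}_{\tau^\mathsf{J}}(x,f\circ\eta))$ with $\mathrm{ke}_\mathbb{N}:=\kappa$, $\mathrm{ke}_{\rho\to\tau}:=\lambda g\,a\,x.\,\mathrm{ke}_\tau(\lambda n.g(n,x),a)$, $\mathrm{ke}_{\rho\times\tau}:=\lambda g\,a.\langle\mathrm{ke}_\rho(\mathsf{pr}_1\circ g,a),\mathrm{ke}_\tau(\mathsf{pr}_2\circ g,a)\rangle$. So $Y^\mathsf{J}:(\mathsf{J}\mathbb{N}\to\mathsf{J}\mathbb{N})\to\mathsf{J}\mathbb{N}$. -}

module Defs where

open import Data.Nat using (ℕ; zero; suc; _<ᵇ_)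
open import Data.Bool using (Bool; true; false; _∧_)
open import Data.List using (List; []; _∷_; length; _∷ʳ_)
open import Data.Product using (_×_; _,_; proj₁; proj₂)
open import Data.Unit using (⊤; tt)
open import Relation.Binary.PropositionalEquality using (_≡_)
open import Relation.Nullary using (¬_)

infixr 7 _⇒_
infixr 8 _⊗_

data Ty : Set where
  ι   : Ty
  _⇒_ : Ty → Ty → Ty
  _⊗_ : Ty → Ty → Ty

Ctx : Set
Ctx = List Ty

data _∋_ : Ctx → Ty → Set where
  here  : ∀ {Γ τ} → (τ ∷ Γ) ∋ τ
  there : ∀ {Γ σ τ} → Γ ∋ τ → (σ ∷ Γ) ∋ τ

data Tm (Γ : Ctx) : Ty → Set where
  var  : ∀ {τ} → Γ ∋ τ → Tm Γ τ
  lam  : ∀ {σ τ} → Tm (σ ∷ Γ) τ → Tm Γ (σ ⇒ τ)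
  app  : ∀ {σ τ} → Tm Γ (σ ⇒ τ) → Tm Γ σ → Tm Γ τ
  zer  : Tm Γ ι
  succ : Tm Γ (ι ⇒ ι)
  rec  : (τ : Ty) → Tm Γ (τ ⇒ (ι ⇒ τ ⇒ τ) ⇒ ι ⇒ τ)
  pair : ∀ {σ τ} → Tm Γ σ → Tm Γ τ → Tm Γ (σ ⊗ τ)
  fst  : ∀ {σ τ} → Tm Γ (σ ⊗ τ) → Tm Γ σ
  snd  : ∀ {σ τ} → Tm Γ (σ ⊗ τ) → Tm Γ τ

-- Interpretation of types over a base type A (A = ℕ: standard
-- functionals; A = JN: the J-translated types)

⟪_⟫_ : Ty → Set → Set
⟪ ι ⟫ A     = A
⟪ σ ⇒ τ ⟫ A = ⟪ σ ⟫ A → ⟪ τ ⟫ A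
⟪ σ ⊗ τ ⟫ A = ⟪ σ ⟫ A × ⟪ τ ⟫ A

Env : Set → Ctx → Set
Env A []      = ⊤
Env A (τ ∷ Γ) = ⟪ τ ⟫ A × Env A Γ

lookupEnv : ∀ {A Γ τ} → Env A Γ → Γ ∋ τ → ⟪ τ ⟫ A
lookupEnv (x , _) here      = x
lookupEnv (_ , ρ) (there i) = lookupEnv ρ i

module Eval (A : Set) (z : A) (s : A → A)
            (r : (τ : Ty) → ⟪ τ ⟫ A → (A → ⟪ τ ⟫ A → ⟪ τ ⟫ A) → A → ⟪ τ ⟫ A) where
  eval : ∀ {Γ τ} → Tm Γ τ → Env A Γ → ⟪ τ ⟫ A
  eval (var i)    ρ = lookupEnv ρ i
  eval (lam t)    ρ = λ x → eval t (x , ρ)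
  eval (app t u)  ρ = eval t ρ (eval u ρ)
  eval zer        ρ = z
  eval succ       ρ = s
  eval (rec τ)    ρ = r τ
  eval (pair t u) ρ = eval t ρ , eval u ρ
  eval (fst t)    ρ = proj₁ (eval t ρ)
  eval (snd t)    ρ = proj₂ (eval t ρ)

natrec : {X : Set} → X → (ℕ → X → X) → ℕ → X
natrec a f zero    = a
natrec a f (suc n) = f n (natrec a f n)

⟦_⟧ty : Ty → Set
⟦ τ ⟧ty = ⟪ τ ⟫ ℕ

⟦_⟧ : ∀ {τ} → Tm [] τ → ⟦ τ ⟧ty
⟦ t ⟧ = Eval.eval ℕ zero suc (λ τ → natrec) t tt

hat : List ℕ → ℕ → ℕ
hat []      n       = 0
hat (x ∷ s) zero    = x
hat (x ∷ s) (suc n) = hat s n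

_*ω_ : List ℕ → (ℕ → ℕ) → ℕ → ℕ
([]    *ω α) n       = α n
((x ∷ s) *ω α) zero    = x
((x ∷ s) *ω α) (suc n) = (s *ω α) n

-- Le(n,k) = 1 iff n < k   (2 = Bool, 1 = true, min = ∧)
Le : ℕ → ℕ → Bool
Le n k = n <ᵇ k

module Nucleus (σ : Ty) where

  BType : Set
  BType = (List ℕ → ⟦ σ ⟧ty) → (List ℕ → (ℕ → ⟦ σ ⟧ty) → ⟦ σ ⟧ty) → List ℕ → ⟦ σ ⟧ty

  JN : Set
  JN = ((ℕ → ℕ) → ℕ) × (List ℕ → Bool) × BType

  V : JN → (ℕ → ℕ) → ℕ
  V w = proj₁ w

  S : JN → List ℕ → Bool
  S w = proj₁ (proj₂ w)

  B : JN → BType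
  B w = proj₂ (proj₂ w)

  η : ℕ → JN
  η n = (λ α → n) , (λ s → true) , (λ G H → G)

  κ : (ℕ → JN) → JN → JN
  κ g w = (λ α → V (g (V w α)) α)
        , (λ s → S w s ∧ S (g (V w (hat s))) s)
        , (λ G H → B w (λ s → B (g (V w (hat s))) G H s) H)

  ke : (τ : Ty) → (ℕ → ⟪ τ ⟫ JN) → JN → ⟪ τ ⟫ JN
  ke ι       g a = κ g a
  ke (ρ ⇒ τ) g a = λ x → ke τ (λ n → g n x) a
  ke (ρ ⊗ τ) g a = ke ρ (λ n → proj₁ (g n)) a , ke τ (λ n → proj₂ (g n)) a

  recJ : (τ : Ty) → ⟪ τ ⟫ JN → (JN → ⟪ τ ⟫ JN → ⟪ τ ⟫ JN) → JN → ⟪ τ ⟫ JN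
  recJ τ x f = ke τ (natrec x (λ n → f (η n)))

  ⟦_⟧J : ∀ {τ} → Tm [] τ → ⟪ τ ⟫ JN
  ⟦ t ⟧J = Eval.eval JN (η 0) (κ (λ n → η (suc n))) recJ t tt

  IsΨ : (ℕ → BType) → Set
  IsΨ Ψ = ∀ n G H s →
      ((n <ᵇ length s) ≡ true → Ψ n G H s ≡ G s)
    × ((n <ᵇ length s) ≡ false → Ψ n G H s ≡ H s (λ m → Ψ n G H (s ∷ʳ m)))

  Ω : (ℕ → BType) → JN → JN
  Ω Ψ = κ (λ n → (λ α → α n) , (λ s → Le n (length s)) , Ψ n)

  Monotone : (List ℕ → Bool) → Set
  Monotone P = ∀ s n → P s ≡ true → P (s ∷ʳ n) ≡ true

  Secures : (List ℕ → Bool) → ((ℕ → ℕ) → ℕ) → Set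
  Secures P Y = ∀ s → P s ≡ true → ∀ α → Y (s *ω α) ≡ Y (hat s)

  GBR : (List ℕ → Bool) → BType → Set
  GBR P ξ = ∀ G H s →
      (P s ≡ true → ξ G H s ≡ G s)
    × (¬ (P s ≡ true) → ξ G H s ≡ H s (λ n → ξ G H (s ∷ʳ n)))

module Submission where

open import Defs
open import Level using (0ℓ)
open import Data.Nat using (ℕ; zero; suc; _<_; _≤_; s≤s)
open import Data.Nat.Properties using (<ᵇ⇒<; <⇒<ᵇ; <-≤-trans; m≤m+n)
open import Data.Bool using (true; _∧_; _≟_)
open import Data.Bool.Properties using (∧-conicalˡ; ∧-conicalʳ; ¬-not; T-≡)
open import Data.List using (List; []; _∷_; length; _∷ʳ_; _++_)
open import Data.List.Properties using (length-++)
open import Data.Product using (_×_; _,_; proj₁; proj₂)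
open import Data.Unit using (⊤; tt)
open import Function.Bundles using (Equivalence)
open import Relation.Nullary using (¬_; yes; no; contradiction)
open import Relation.Binary.PropositionalEquality
open import Axiom.Extensionality.Propositional using (Extensionality)

-- A logical relation between α-indexed standard values and J-values: at ℕ it
-- says that V w is the indexed value and that w is adequate (S w is monotone
-- and secures V w, and B w is general bar recursion for S w).  η, κ and hence
-- ke and rec^J preserve it, so every term of T is related to its J-translation.
-- Ω is related to the identity because its n-th component has S = "n < |s|",
-- which secures α ↦ α n; applying Y^J to Ω yields the theorem.

hat-∷ʳ : ∀ s n k → hat (s ∷ʳ n) k ≡ (s *ω hat (n ∷ [])) k
hat-∷ʳ []      n k       = refl
hat-∷ʳ (x ∷ s) n zero    = refl
hat-∷ʳ (x ∷ s) n (suc k) = hat-∷ʳ s n k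

*ω-hat-< : ∀ s α n → n < length s → (s *ω α) n ≡ hat s n
*ω-hat-< (x ∷ s) α zero    _         = refl
*ω-hat-< (x ∷ s) α (suc n) (s≤s n<s) = *ω-hat-< s α n n<s

Le⇒< : ∀ {n k} → Le n k ≡ true → n < k
Le⇒< {n} {k} Le-n-k = <ᵇ⇒< n k (Equivalence.from T-≡ Le-n-k)

<⇒Le : ∀ {n k} → n < k → Le n k ≡ true
<⇒Le n<k = Equivalence.to T-≡ (<⇒<ᵇ n<k)

Le-length-++ : ∀ n (s t : List ℕ) → Le n (length s) ≡ true → Le n (length (s ++ t)) ≡ true
Le-length-++ n s t Le-n-s = <⇒Le (<-≤-trans (Le⇒< Le-n-s) length-s≤)
  where
  length-s≤ : length s ≤ length (s ++ t)
  length-s≤ = subst (length s ≤_) (sym (length-++ s {t})) (m≤m+n (length s) (length t))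

module Adequacy (ext : Extensionality 0ℓ 0ℓ) (σ : Ty) where
  open Nucleus σ

  record Adequate (w : JN) : Set where
    field
      monotone : Monotone (S w)
      secures  : Secures (S w) (V w)
      gbr      : GBR (S w) (B w)

    V-hat-∷ʳ : ∀ s n → S w s ≡ true → V w (hat (s ∷ʳ n)) ≡ V w (hat s)
    V-hat-∷ʳ s n Ss = trans (cong (V w) (ext (hat-∷ʳ s n))) (secures s Ss (hat (n ∷ [])))

  open Adequate

  η-adequate : ∀ n → Adequate (η n)
  η-adequate n = record
    { monotone = λ _ _ _ → refl
    ; secures  = λ _ _ _ → refl
    ; gbr      = λ _ _ _ → (λ _ → refl) , (λ ¬S → contradiction refl ¬S)
    }

  module _ {g : ℕ → JN} {w : JN} (g-adequate : ∀ n → Adequate (g n)) (w-adequate : Adequate w) where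

    κ-monotone : Monotone (S (κ g w))
    κ-monotone s n Sκ = cong₂ _∧_ (monotone w-adequate s n Sw) Sg-∷ʳ
      where
      Sw = ∧-conicalˡ _ _ Sκ
      Sg-∷ʳ : S (g (V w (hat (s ∷ʳ n)))) (s ∷ʳ n) ≡ true
      Sg-∷ʳ = subst (λ k → S (g k) (s ∷ʳ n) ≡ true) (sym (V-hat-∷ʳ w-adequate s n Sw))
                (monotone (g-adequate (V w (hat s))) s n (∧-conicalʳ _ _ Sκ))

    κ-secures : Secures (S (κ g w)) (V (κ g w))
    κ-secures s Sκ α = begin
      V (g (V w (s *ω α))) (s *ω α) ≡⟨ cong (λ k → V (g k) (s *ω α)) (secures w-adequate s (∧-conicalˡ _ _ Sκ) α) ⟩
      V (g (V w (hat s))) (s *ω α)  ≡⟨ secures (g-adequate (V w (hat s))) s (∧-conicalʳ _ _ Sκ) α ⟩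
      V (g (V w (hat s))) (hat s)   ∎
      where open ≡-Reasoning

    κ-gbr : GBR (S (κ g w)) (B (κ g w))
    κ-gbr G H s = at-bar , off-bar
      where
      open ≡-Reasoning
      G′ : List ℕ → ⟦ σ ⟧ty
      G′ t = B (g (V w (hat t))) G H t
      k = V w (hat s)

      at-bar : S (κ g w) s ≡ true → B w G′ H s ≡ G s
      at-bar Sκ = begin
        B w G′ H s     ≡⟨ proj₁ (gbr w-adequate G′ H s) (∧-conicalˡ _ _ Sκ) ⟩
        B (g k) G H s  ≡⟨ proj₁ (gbr (g-adequate k) G H s) (∧-conicalʳ _ _ Sκ) ⟩
        G s            ∎

      off-bar : ¬ S (κ g w) s ≡ true → B w G′ H s ≡ H s (λ n → B w G′ H (s ∷ʳ n))
      off-bar ¬Sκ with S w s ≟ true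
      ... | no ¬Sw = proj₂ (gbr w-adequate G′ H s) ¬Sw
      ... | yes Sw = begin
        B w G′ H s                          ≡⟨ proj₁ (gbr w-adequate G′ H s) Sw ⟩
        B (g k) G H s                       ≡⟨ proj₂ (gbr (g-adequate k) G H s) (λ Sg → ¬Sκ (cong₂ _∧_ Sw Sg)) ⟩
        H s (λ n → B (g k) G H (s ∷ʳ n))    ≡⟨ cong (H s) (ext λ n → sym (B-∷ʳ n)) ⟩
        H s (λ n → B w G′ H (s ∷ʳ n))       ∎
        where
        -- past a bar of w, w hands over to g k at every one-step extension
        B-∷ʳ : ∀ n → B w G′ H (s ∷ʳ n) ≡ B (g k) G H (s ∷ʳ n)
        B-∷ʳ n = trans (proj₁ (gbr w-adequate G′ H (s ∷ʳ n)) (monotone w-adequate s n Sw))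
                       (cong (λ k′ → B (g k′) G H (s ∷ʳ n)) (V-hat-∷ʳ w-adequate s n Sw))

    κ-adequate : Adequate (κ g w)
    κ-adequate = record { monotone = κ-monotone ; secures = κ-secures ; gbr = κ-gbr }

  Related : (τ : Ty) → ((ℕ → ℕ) → ⟦ τ ⟧ty) → ⟪ τ ⟫ JN → Set
  Related ι       f w = (∀ α → V w α ≡ f α) × Adequate w
  Related (ρ ⇒ τ) f g = ∀ a x → Related ρ a x → Related τ (λ α → f α (a α)) (g x)
  Related (ρ ⊗ τ) f p = Related ρ (λ α → proj₁ (f α)) (proj₁ p)
                      × Related τ (λ α → proj₂ (f α)) (proj₂ p)

  related-η : ∀ n → Related ι (λ _ → n) (η n)
  related-η n = (λ _ → refl) , η-adequate n

  related-κ : ∀ {h : ℕ → (ℕ → ℕ) → ℕ} {g m w} → (∀ n → Related ι (h n) (g n)) →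
              Related ι m w → Related ι (λ α → h (m α) α) (κ g w)
  related-κ {g = g} related-g (V≗m , w-adequate) =
    (λ α → trans (cong (λ k → V (g k) α) (V≗m α)) (proj₁ (related-g _) α)) ,
    κ-adequate (λ n → proj₂ (related-g n)) w-adequate

  related-ke : ∀ τ {h : ℕ → (ℕ → ℕ) → ⟦ τ ⟧ty} {g m w} → (∀ n → Related τ (h n) (g n)) →
               Related ι m w → Related τ (λ α → h (m α) α) (ke τ g w)
  related-ke ι       related-g related-w = related-κ related-g related-w
  related-ke (ρ ⇒ τ) related-g related-w a x related-a =
    related-ke τ (λ n → related-g n a x related-a) related-w
  related-ke (ρ ⊗ τ) related-g related-w =
    related-ke ρ (λ n → proj₁ (related-g n)) related-w ,
    related-ke τ (λ n → proj₂ (related-g n)) related-w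

  related-natrec : ∀ τ {a x f F} → Related τ a x → Related (ι ⇒ τ ⇒ τ) f F → ∀ n →
                   Related τ (λ α → natrec (a α) (f α) n) (natrec x (λ n → F (η n)) n)
  related-natrec τ related-a related-f zero    = related-a
  related-natrec τ related-a related-f (suc n) =
    related-f _ _ (related-η n) _ _ (related-natrec τ related-a related-f n)

  related-recJ : ∀ τ → Related (τ ⇒ (ι ⇒ τ ⇒ τ) ⇒ ι ⇒ τ) (λ _ → natrec) (recJ τ)
  related-recJ τ a x related-a f F related-f m w related-m =
    related-ke τ (related-natrec τ related-a related-f) related-m

  RelatedEnv : ∀ Γ → ((ℕ → ℕ) → Env ℕ Γ) → Env JN Γ → Set
  RelatedEnv []      _ _ = ⊤
  RelatedEnv (τ ∷ Γ) ρ ρᴶ = Related τ (λ α → proj₁ (ρ α)) (proj₁ ρᴶ)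
                          × RelatedEnv Γ (λ α → proj₂ (ρ α)) (proj₂ ρᴶ)

  related-lookup : ∀ {Γ τ} (i : Γ ∋ τ) {ρ ρᴶ} → RelatedEnv Γ ρ ρᴶ →
                   Related τ (λ α → lookupEnv (ρ α) i) (lookupEnv ρᴶ i)
  related-lookup here      (related-x , _) = related-x
  related-lookup (there i) (_ , related-ρ) = related-lookup i related-ρ

  module Std = Eval ℕ zero suc (λ _ → natrec)
  module Jtr = Eval JN (η 0) (κ (λ n → η (suc n))) recJ

  fundamental : ∀ {Γ τ} (t : Tm Γ τ) {ρ ρᴶ} → RelatedEnv Γ ρ ρᴶ →
                Related τ (λ α → Std.eval t (ρ α)) (Jtr.eval t ρᴶ)
  fundamental (var i)    related-ρ = related-lookup i related-ρ
  fundamental (lam t)    related-ρ a x related-a = fundamental t (related-a , related-ρ)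
  fundamental (app t u)  related-ρ = fundamental t related-ρ _ _ (fundamental u related-ρ)
  fundamental zer        related-ρ = related-η 0
  fundamental succ       related-ρ a w related-a = related-κ (λ n → related-η (suc n)) related-a
  fundamental (rec τ)    related-ρ = related-recJ τ
  fundamental (pair t u) related-ρ = fundamental t related-ρ , fundamental u related-ρ
  fundamental (fst t)    related-ρ = proj₁ (fundamental t related-ρ)
  fundamental (snd t)    related-ρ = proj₂ (fundamental t related-ρ)

  module _ (Ψ : ℕ → BType) (Ψ-spec : IsΨ Ψ) where

    coordinate : ℕ → JN
    coordinate n = (λ α → α n) , (λ s → Le n (length s)) , Ψ n

    coordinate-adequate : ∀ n → Adequate (coordinate n)
    coordinate-adequate n = record
      { monotone = λ s m → Le-length-++ n s (m ∷ [])
      ; secures  = λ s n<s α → *ω-hat-< s α n (Le⇒< n<s)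
      ; gbr      = λ G H s → proj₁ (Ψ-spec n G H s) , λ n≮s → proj₂ (Ψ-spec n G H s) (¬-not n≮s)
      }

    related-Ω : Related (ι ⇒ ι) (λ α → α) (Ω Ψ)
    related-Ω a w related-a =
      related-κ (λ n → (λ _ → refl) , coordinate-adequate n) related-a

    related-Yᴶ-Ω : (Y : Tm [] ((ι ⇒ ι) ⇒ ι)) → Related ι ⟦ Y ⟧ (⟦ Y ⟧J (Ω Ψ))
    related-Yᴶ-Ω Y = fundamental Y {ρ = λ _ → tt} tt (λ α → α) (Ω Ψ) related-Ω

theorem11 : Extensionality 0ℓ 0ℓ →
    (σ : Ty) (Ψ : ℕ → Nucleus.BType σ) → Nucleus.IsΨ σ Ψ →
    (Y : Tm [] ((ι ⇒ ι) ⇒ ι)) →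
    let open Nucleus σ
        w = ⟦ Y ⟧J (Ω Ψ)
    in (Monotone (S w) × Secures (S w) ⟦ Y ⟧)
       × GBR (S w) (B w)
theorem11 ext σ Ψ Ψ-spec Y = (monotone adequate , Y-secured) , gbr adequate
  where
  open Nucleus σ
  open Adequacy ext σ
  open Adequate
  w = ⟦ Y ⟧J (Ω Ψ)
  V≗Y = proj₁ (related-Yᴶ-Ω Ψ Ψ-spec Y)
  adequate = proj₂ (related-Yᴶ-Ω Ψ Ψ-spec Y)

  Y-secured : Secures (S w) ⟦ Y ⟧
  Y-secured s Ss α = begin
    ⟦ Y ⟧ (s *ω α) ≡⟨ sym (V≗Y (s *ω α)) ⟩
    V w (s *ω α)   ≡⟨ secures adequate s Ss α ⟩
    V w (hat s)    ≡⟨ V≗Y (hat s) ⟩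
    ⟦ Y ⟧ (hat s)  ∎
    where open ≡-Reasoning
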